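{- Let $B\in\mathbb{Z}^{w\times k}$ and $r\ge 2$, and suppose that for all sufficiently large $n$, every $r$-coloring of $[n]$ admits a monochromatic solution $x\in[n]^k$ to the system $Bx=0$. Then there exists $\epsilon>0$ such that for all sufficiently large $n$, for every $r$-coloring of $[n]$ and every subset $A\subseteq[n]$ with $|A|\ge(1-\epsilon)n$, there is a monochromatic solution $x\in A^k$ to $Bx=0$.
   Context: $[n]=\{1,\dots,n\}$. A solution $x=(x_1,\dots,x_k)$ is monochromatic if all $x_i$ receive the same color. -}

module Defs where

open import Data.Nat using (ℕ; suc)
open import Data.Fin using (Fin; toℕ)
open import Data.Fin.Subset using (Subset; _∈_)
open import Data.Integer using (ℤ; +_; _*_; _+_)
open import Data.Vec.Functional using (foldr)
open import Data.Product using (∃; _×_)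
open import Relation.Binary.PropositionalEquality using (_≡_)

-- [n] = {1,…,n} is represented by Fin n, with  i : Fin n  standing for
-- the integer  toℕ i + 1.
value : {n : ℕ} → Fin n → ℤ
value i = + suc (toℕ i)

Σ : {k : ℕ} → (Fin k → ℤ) → ℤ
Σ f = foldr _+_ (+ 0) f

IsSolution : {w k n : ℕ} → (Fin w → Fin k → ℤ) → (Fin k → Fin n) → Set
IsSolution {w} B x = (j : Fin w) → Σ (λ i → B j i * value (x i)) ≡ + 0

Coloring : ℕ → ℕ → Set
Coloring r n = Fin n → Fin r

Monochromatic : {r k n : ℕ} → Coloring r n → (Fin k → Fin n) → Set
Monochromatic {r} c x = ∃ λ (col : Fin r) → ∀ i → c (x i) ≡ col

AllIn : {k n : ℕ} → Subset n → (Fin k → Fin n) → Set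
AllIn A x = ∀ i → x i ∈ A

HasMonoSolutionIn : {w k : ℕ} → (Fin w → Fin k → ℤ) → (r n : ℕ) → Subset n → Set
HasMonoSolutionIn B r n A =
  (c : Coloring r n) → ∃ λ x → IsSolution B x × Monochromatic c x × AllIn A x

-- Solutions of a homogeneous system are closed under dilation, so it suffices to find
-- one dilate t·[n₀] inside A with t·n₀ ≤ n: colouring [n₀] by j ↦ c (t j) and dilating
-- a monochromatic solution in [n₀] by t gives one in A. If M elements of [n] are missing
-- from A, each of them lies in at most n₀ of the dilates t·[n₀], so among the
-- n₀ M + 1 dilates t = 1, …, n₀ M + 1 one avoids all of them; it fits in [n] as soon as
-- (n₀² + n₀ + 1) M ≤ n and n₀ ≤ n, which the choice ε = 1/(n₀² + n₀ + 1) ensures.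
module Submission where

open import Defs
open import Data.Nat using (ℕ; _≥_)
open import Data.Fin using (Fin)
open import Data.Fin.Subset using (Subset; ∣_∣; ⊤)
open import Data.Integer using (ℤ; +_)
open import Data.Rational using (ℚ; 0ℚ; 1ℚ; _-_; _*_; _<_; _≤_) renaming (_/_ to _÷_)
open import Data.Product using (∃; _×_)

open import Data.Bool.Base using (true; false)
open import Data.Empty using (⊥-elim)
open import Data.Nat as ℕ using (zero; suc)
import Data.Nat.Properties as ℕ
open import Data.Nat.Tactic.RingSolver using (solve-∀)
open import Data.Nat.Coprimality as Coprimality using (1-coprimeTo)
import Data.Integer as ℤ
import Data.Integer.Properties as ℤ
open import Data.Rational using (mkℚ; toℚᵘ; -_)
open import Data.Rational.Properties
  using (positive⁻¹; normalize-coprime; toℚᵘ-mono-≤; toℚᵘ-homo-*; toℚᵘ-homo-+; toℚᵘ-homo‿-)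
import Data.Rational.Unnormalised as ℚᵘ
import Data.Rational.Unnormalised.Properties as ℚᵘ
open import Data.Fin as Fin using (toℕ; fromℕ<; combine)
import Data.Fin.Properties as Fin
open import Data.Fin.Subset using (_∈_; _∉_; ∁)
open import Data.Fin.Subset.Properties using (_∈?_; x∉p⇒x∈∁p; ∣∁p∣≡n∸∣p∣; ∣p∣≤n)
open import Data.Vec.Base using (_∷_; here; there)
open import Data.Product using (_,_; proj₁; proj₂)
open import Function using (_∘_)
open import Relation.Nullary using (yes; no)
open import Relation.Binary.PropositionalEquality using (_≡_; refl; sym; trans; cong; module ≡-Reasoning)
open import Algebra.Properties.Semiring.Sum ℤ.+-*-semiring using (sum-cong-≗; *-distribˡ-sum)
open import Algebra.Properties.CommutativeSemigroup ℤ.*-commutativeSemigroup using (x∙yz≈y∙xz)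

IsSolution-dilate : ∀ {w k m n} (B : Fin w → Fin k → ℤ) {x : Fin k → Fin m} {y : Fin k → Fin n}
  (t : ℤ) → (∀ i → value (y i) ≡ t ℤ.* value (x i)) → IsSolution B x → IsSolution B y
IsSolution-dilate B {x} {y} t y≡t*x sol j = begin
  Σ (λ i → B j i ℤ.* value (y i))          ≡⟨ sum-cong-≗ termwise ⟩
  Σ (λ i → t ℤ.* (B j i ℤ.* value (x i)))  ≡⟨ *-distribˡ-sum t (λ i → B j i ℤ.* value (x i)) ⟨
  t ℤ.* Σ (λ i → B j i ℤ.* value (x i))    ≡⟨ cong (t ℤ.*_) (sol j) ⟩
  t ℤ.* + 0                                ≡⟨ ℤ.*-zeroʳ t ⟩
  + 0                                      ∎
  where
  open ≡-Reasoning
  termwise : ∀ i → B j i ℤ.* value (y i) ≡ t ℤ.* (B j i ℤ.* value (x i))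
  termwise i = trans (cong (B j i ℤ.*_) (y≡t*x i)) (x∙yz≈y∙xz (B j i) t (value (x i)))

HasMonoSolutionIn-dilate : ∀ {w k} (B : Fin w → Fin k → ℤ) {r m n} {A : Subset n}
  (q : Fin m → Fin n) (t : ℤ) → (∀ j → value (q j) ≡ t ℤ.* value j) → (∀ j → q j ∈ A) →
  HasMonoSolutionIn B r m ⊤ → HasMonoSolutionIn B r n A
HasMonoSolutionIn-dilate B q t q≡t* q∈A H c
  with x , sol , (col , mono) , _ ← H (c ∘ q)
  = q ∘ x , IsSolution-dilate B t (q≡t* ∘ x) sol , (col , mono) , q∈A ∘ x

value-injective : ∀ {n} {i j : Fin n} → value i ≡ value j → i ≡ j
value-injective = Fin.toℕ-injective ∘ ℕ.suc-injective ∘ ℤ.+-injective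

dilate : ∀ {T N n} → T ℕ.* N ℕ.≤ n → Fin T → Fin N → Fin n
dilate T*N≤n t j = fromℕ< (ℕ.≤-trans (ℕ.*-mono-≤ (Fin.toℕ<n t) (Fin.toℕ<n j)) T*N≤n)

value-dilate : ∀ {T N n} (T*N≤n : T ℕ.* N ℕ.≤ n) (t : Fin T) (j : Fin N) →
  value (dilate T*N≤n t j) ≡ value t ℤ.* value j
value-dilate T*N≤n t j = trans (cong (+_ ∘ suc) (Fin.toℕ-fromℕ< _)) (ℤ.pos-* (suc (toℕ t)) (suc (toℕ j)))

dilate-injectiveˡ : ∀ {T N n} (T*N≤n : T ℕ.* N ℕ.≤ n) (t t' : Fin T) (j : Fin N) →
  dilate T*N≤n t j ≡ dilate T*N≤n t' j → t ≡ t'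
dilate-injectiveˡ T*N≤n t t' j eq = value-injective (ℤ.*-cancelʳ-≡ (value t) (value t') (value j) (begin
  value t ℤ.* value j        ≡⟨ value-dilate T*N≤n t j ⟨
  value (dilate T*N≤n t j)   ≡⟨ cong value eq ⟩
  value (dilate T*N≤n t' j)  ≡⟨ value-dilate T*N≤n t' j ⟩
  value t' ℤ.* value j       ∎))
  where open ≡-Reasoning

rank : ∀ {n} {x : Fin n} (p : Subset n) → x ∈ p → Fin ∣ p ∣
rank (true ∷ p)  here        = Fin.zero
rank (true ∷ p)  (there x∈p) = Fin.suc (rank p x∈p)
rank (false ∷ p) (there x∈p) = rank p x∈p

rank-injective : ∀ {n} {x y : Fin n} (p : Subset n) (x∈p : x ∈ p) (y∈p : y ∈ p) →
  rank p x∈p ≡ rank p y∈p → x ≡ y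
rank-injective (true ∷ p)  here        here        _  = refl
rank-injective (true ∷ p)  (there x∈p) (there y∈p) eq = cong Fin.suc (rank-injective p x∈p y∈p (Fin.suc-injective eq))
rank-injective (false ∷ p) (there x∈p) (there y∈p) eq = cong Fin.suc (rank-injective p x∈p y∈p eq)

-- Pigeonhole: a dilate missing A is sent to the pair (j, x) with x = dilate t j ∉ A
-- (x coded by its rank in ∁ A), and t is recovered from that pair.
∃dilate⊆ : ∀ {T N n} (A : Subset n) (T*N≤n : T ℕ.* N ℕ.≤ n) → N ℕ.* ∣ ∁ A ∣ ℕ.< T →
  ∃ λ t → ∀ j → dilate T*N≤n t j ∈ A
∃dilate⊆ {T} {N} A T*N≤n N*M<T with Fin.any? (λ t → Fin.all? (λ j → dilate T*N≤n t j ∈? A))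
... | yes fits = fits
... | no ¬fits =
  let t , t' , t<t' , eq = Fin.pigeonhole N*M<T witness
      j≡j' , code≡code' = Fin.combine-injective (missed t) (code t) (missed t') (code t') eq
      x≡x' = rank-injective (∁ A) (missing t) (missing t') code≡code'
      t≡t' = dilate-injectiveˡ T*N≤n t t' (missed t) (trans x≡x' (cong (dilate T*N≤n t') (sym j≡j')))
  in  ⊥-elim (Fin.<-irrefl t≡t' t<t')
  where
  miss : ∀ t → ∃ λ j → dilate T*N≤n t j ∉ A
  miss t = Fin.¬∀⟶∃¬ N _ (λ j → dilate T*N≤n t j ∈? A) (λ t-fits → ¬fits (t , t-fits))

  missed : Fin T → Fin N
  missed = proj₁ ∘ miss

  missing : ∀ t → dilate T*N≤n t (missed t) ∈ ∁ A
  missing = x∉p⇒x∈∁p ∘ proj₂ ∘ miss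

  code : ∀ t → Fin ∣ ∁ A ∣
  code t = rank (∁ A) (missing t)

  witness : Fin T → Fin (N ℕ.* ∣ ∁ A ∣)
  witness t = combine (missed t) (code t)

1/[1+_] : ℕ → ℚ
1/[1+ m ] = mkℚ (+ 1) m (1-coprimeTo (suc m))

toℚᵘ-÷1 : ∀ a → toℚᵘ (+ a ÷ 1) ≡ ℚᵘ.mkℚᵘ (+ a) 0
toℚᵘ-÷1 a = cong toℚᵘ (normalize-coprime (Coprimality.sym (1-coprimeTo a)))

clear-denominators : ∀ m n a → (1ℚ - 1/[1+ m ]) * (+ n ÷ 1) ≤ + a ÷ 1 → m ℕ.* n ℕ.≤ suc m ℕ.* a
clear-denominators m n a le = ℤ.drop‿+≤+ (begin
  + (m ℕ.* n)          ≡⟨ trans (ℤ.*-identityʳ (ℚᵘ.↥ L)) ↥L≡m*n ⟨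
  ℚᵘ.↥ L ℤ.* + 1       ≤⟨ ℚᵘ.drop-*≤* L≤a ⟩
  + a ℤ.* ℚᵘ.↧ L       ≡⟨ cong (+ a ℤ.*_) ↧L≡1+m ⟩
  + a ℤ.* + suc m      ≡⟨ ℤ.pos-* a (suc m) ⟨
  + (a ℕ.* suc m)      ≡⟨ cong +_ (ℕ.*-comm a (suc m)) ⟩
  + (suc m ℕ.* a)      ∎)
  where
  open ℤ.≤-Reasoning

  L : ℚᵘ.ℚᵘ
  L = (toℚᵘ 1ℚ ℚᵘ.- toℚᵘ 1/[1+ m ]) ℚᵘ.* ℚᵘ.mkℚᵘ (+ n) 0

  ↥L≡m*n : ℚᵘ.↥ L ≡ + (m ℕ.* n)
  ↥L≡m*n = trans (ℤ.+◃n≡+n _) (cong (λ k → + (k ℕ.* n)) (ℕ.+-identityʳ m))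

  ↧L≡1+m : ℚᵘ.↧ L ≡ + suc m
  ↧L≡1+m = cong (+_ ∘ suc) (trans (ℕ.*-identityʳ _) (ℕ.+-identityʳ m))

  toℚᵘ-lhs : toℚᵘ ((1ℚ - 1/[1+ m ]) * (+ n ÷ 1)) ℚᵘ.≃ L
  toℚᵘ-lhs = ℚᵘ.≃-trans (toℚᵘ-homo-* (1ℚ - 1/[1+ m ]) (+ n ÷ 1))
    (ℚᵘ.*-cong (ℚᵘ.≃-trans (toℚᵘ-homo-+ 1ℚ (- 1/[1+ m ])) (ℚᵘ.+-congʳ (toℚᵘ 1ℚ) (toℚᵘ-homo‿- 1/[1+ m ])))
               (ℚᵘ.≃-reflexive (toℚᵘ-÷1 n)))

  L≤a : L ℚᵘ.≤ ℚᵘ.mkℚᵘ (+ a) 0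
  L≤a = ℚᵘ.≤-respˡ-≃ toℚᵘ-lhs (ℚᵘ.≤-respʳ-≃ (ℚᵘ.≃-reflexive (toℚᵘ-÷1 a)) (toℚᵘ-mono-≤ le))

complement-bound : ∀ m n a M → m ℕ.* n ℕ.≤ suc m ℕ.* a → M ℕ.+ a ≡ n → suc m ℕ.* M ℕ.≤ n
complement-bound m n a M m*n≤[1+m]*a M+a≡n = ℕ.+-cancelʳ-≤ (suc m ℕ.* a) _ _ (begin
  suc m ℕ.* M ℕ.+ suc m ℕ.* a  ≡⟨ ℕ.*-distribˡ-+ (suc m) M a ⟨
  suc m ℕ.* (M ℕ.+ a)          ≡⟨ cong (suc m ℕ.*_) M+a≡n ⟩
  n ℕ.+ m ℕ.* n                ≤⟨ ℕ.+-monoʳ-≤ n m*n≤[1+m]*a ⟩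
  n ℕ.+ suc m ℕ.* a            ∎)
  where open ℕ.≤-Reasoning

dilation-room : ∀ N M n → N ℕ.≤ n → N ℕ.* suc N ℕ.* M ℕ.≤ n → suc (N ℕ.* M) ℕ.* N ℕ.≤ n
dilation-room N zero n N≤n _ = begin
  suc (N ℕ.* 0) ℕ.* N  ≡⟨ cong (λ k → suc k ℕ.* N) (ℕ.*-zeroʳ N) ⟩
  1 ℕ.* N              ≡⟨ ℕ.*-identityˡ N ⟩
  N                    ≤⟨ N≤n ⟩
  n                    ∎
  where open ℕ.≤-Reasoning
dilation-room N M@(suc _) n _ N*[1+N]*M≤n = begin
  N ℕ.+ N ℕ.* M ℕ.* N          ≤⟨ ℕ.+-monoˡ-≤ (N ℕ.* M ℕ.* N) (ℕ.m≤m*n N M) ⟩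
  N ℕ.* M ℕ.+ N ℕ.* M ℕ.* N    ≡⟨ regroup N M ⟩
  N ℕ.* suc N ℕ.* M            ≤⟨ N*[1+N]*M≤n ⟩
  n                            ∎
  where
  open ℕ.≤-Reasoning
  regroup : ∀ N M → N ℕ.* M ℕ.+ N ℕ.* M ℕ.* N ≡ N ℕ.* suc N ℕ.* M
  regroup = solve-∀

proposition3p1 : (w k : ℕ) (B : Fin w → Fin k → ℤ) (r : ℕ) → r ≥ 2 →
    (∃ λ n₀ → ∀ n → n ≥ n₀ → HasMonoSolutionIn B r n ⊤) →
    ∃ λ (ε : ℚ) → 0ℚ < ε × (∃ λ n₀ → ∀ n → n ≥ n₀ → (A : Subset n) →
      (1ℚ - ε) * (+ n ÷ 1) ≤ (+ ∣ A ∣ ÷ 1) → HasMonoSolutionIn B r n A)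
proposition3p1 w k B r _ (N , H) = 1/[1+ m ] , positive⁻¹ 1/[1+ m ] , N , dense⇒mono
  where
  m : ℕ
  m = N ℕ.* suc N

  dense⇒mono : ∀ n → n ≥ N → (A : Subset n) →
    (1ℚ - 1/[1+ m ]) * (+ n ÷ 1) ≤ (+ ∣ A ∣ ÷ 1) → HasMonoSolutionIn B r n A
  dense⇒mono n N≤n A dense =
    let t , t·[N]⊆A = ∃dilate⊆ A room ℕ.≤-refl
    in  HasMonoSolutionIn-dilate B (dilate room t) (value t) (value-dilate room t) t·[N]⊆A (H N ℕ.≤-refl)
    where
    M : ℕ
    M = ∣ ∁ A ∣

    M+∣A∣≡n : M ℕ.+ ∣ A ∣ ≡ n
    M+∣A∣≡n = trans (cong (ℕ._+ ∣ A ∣) (∣∁p∣≡n∸∣p∣ A)) (ℕ.m∸n+n≡m (∣p∣≤n A))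

    [1+m]*M≤n : suc m ℕ.* M ℕ.≤ n
    [1+m]*M≤n = complement-bound m n ∣ A ∣ M (clear-denominators m n ∣ A ∣ dense) M+∣A∣≡n

    room : suc (N ℕ.* M) ℕ.* N ℕ.≤ n
    room = dilation-room N M n N≤n (ℕ.≤-trans (ℕ.m≤n+m (m ℕ.* M) M) [1+m]*M≤n)
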